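{- Suppose a decision tree processing strings of length $n$ has basic height $k$. Then it is equivalent to a decision tree processing strings of length $n$ of height at most $k+n$.
   Context: Strings are over a totally ordered alphabet. A decision tree processing strings of length $n$ is a rooted ternary tree in which each interior vertex is labeled with an ordered pair $(i,j)$, $1\le i,j\le n$, and its three outgoing edges are labeled $<$, $=$, $>$. A string $t$ of length $n$ reaches a vertex $v$ if along the root-to-$v$ path, every vertex labeled $(i,j)$ is left via the edge labeled by the actual relation between $t[i]$ and $t[j]$; each string reaches exactly one leaf. The height of a tree is the maximal number of edges on a root-to-leaf path. The basic height is the minimal $k$ such that every root-to-leaf path has at most $k$ edges labeled $<$ or $>$. Two decision trees processing strings of length $n$ are equivalent if for each reachable leaf $a$ of the first tree there is a leaf $b$ of the second tree such that for every string $t$ of length $n$, $t$ reaches $a$ iff $t$ reaches $b$. -}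

module Defs where

open import Level using (Level) renaming (_⊔_ to _⊔ˡ_)
open import Data.Nat using (ℕ; zero; suc; _⊔_)
open import Data.Fin using (Fin)
open import Data.Product using (Σ; ∃; _×_)
open import Function.Bundles using (_⇔_)
open import Relation.Binary.Bundles using (StrictTotalOrder)

-- Decision trees processing strings of length n: ternary trees whose
-- interior vertices are labelled by a pair (i , j) of positions;
-- the three subtrees correspond to the edges labelled <, =, >.
data DTree (n : ℕ) : Set where
  leaf : DTree n
  node : (i j : Fin n) → (lt eq gt : DTree n) → DTree n

data LeafOf {n : ℕ} : DTree n → Set where
  here  : LeafOf leaf
  viaLt : ∀ {i j l e g} → LeafOf l → LeafOf (node i j l e g)
  viaEq : ∀ {i j l e g} → LeafOf e → LeafOf (node i j l e g)
  viaGt : ∀ {i j l e g} → LeafOf g → LeafOf (node i j l e g)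

height : ∀ {n} → DTree n → ℕ
height leaf = 0
height (node i j l e g) = suc (height l ⊔ height e ⊔ height g)

basicHeight : ∀ {n} → DTree n → ℕ
basicHeight leaf = 0
basicHeight (node i j l e g) =
  suc (basicHeight l) ⊔ basicHeight e ⊔ suc (basicHeight g)

module _ {a ℓ₁ ℓ₂ : Level} (O : StrictTotalOrder a ℓ₁ ℓ₂) where
  open StrictTotalOrder O renaming (Carrier to A)

  String : ℕ → Set a
  String n = Fin n → A

  data Reaches {n : ℕ} (t : String n) : (T : DTree n) → LeafOf T → Set (a ⊔ˡ ℓ₁ ⊔ˡ ℓ₂) where
    rHere : Reaches t leaf here
    rLt : ∀ {i j l e g p} → t i < t j → Reaches t l p →
          Reaches t (node i j l e g) (viaLt p)
    rEq : ∀ {i j l e g p} → t i ≈ t j → Reaches t e p →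
          Reaches t (node i j l e g) (viaEq p)
    rGt : ∀ {i j l e g p} → t j < t i → Reaches t g p →
          Reaches t (node i j l e g) (viaGt p)

  Reachable : ∀ {n} (T : DTree n) → LeafOf T → Set (a ⊔ˡ ℓ₁ ⊔ˡ ℓ₂)
  Reachable {n} T p = ∃ λ (t : String n) → Reaches t T p

  Equivalent : ∀ {n} → DTree n → DTree n → Set (a ⊔ˡ ℓ₁ ⊔ˡ ℓ₂)
  Equivalent {n} T₁ T₂ =
    (p : LeafOf T₁) → Reachable T₁ p →
    Σ (LeafOf T₂) λ q → (t : String n) → Reaches t T₁ p ⇔ Reaches t T₂ q

-- Along a root-to-vertex path the "=" answers received so far force some
-- positions to carry equal letters; these form a partition of the positions.
-- Deleting every vertex whose two positions already lie in one block (its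
-- answer is forced to be "=") yields an equivalent tree in which each
-- remaining "=" edge merges two blocks.  Starting from the n singleton blocks,
-- a path can therefore take at most n "=" edges besides its at most k
-- "<"/">" edges.
module Submission where

open import Defs
open import Level using (Level)
open import Data.Nat using (ℕ; suc; _+_; _⊔_; _≤_; _<_; z≤n; s≤s)
open import Data.Nat.Properties
  using (≤-trans; ≤-reflexive; m≤m⊔n; m≤n⊔m; ⊔-lub; +-suc; +-mono-≤; +-monoˡ-≤; +-monoʳ-≤)
open import Data.Fin using (Fin)
open import Data.Fin.Properties using (_≟_)
open import Data.Fin.Subset using (Subset; _∈_; _⊂_; ∣_∣)
open import Data.Fin.Subset.Properties using (p⊂q⇒∣p∣<∣q∣; ∣p∣≤n)
open import Data.Vec using (tabulate)
open import Data.Vec.Properties using (lookup∘tabulate; lookup⇒[]=; []=⇒lookup)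
open import Data.Product using (Σ; _×_; _,_)
open import Data.Empty using (⊥-elim)
open import Function using (id)
open import Function.Bundles using (_⇔_; mk⇔; Equivalence)
open import Function.Properties.Equivalence using () renaming (refl to ⇔-refl; trans to ⇔-trans)
open import Relation.Nullary using (yes; no; ¬_; does; contradiction)
open import Relation.Nullary.Decidable using (dec-true)
open import Relation.Binary.Bundles using (StrictTotalOrder)
open import Relation.Binary.PropositionalEquality using (_≡_; refl; sym; trans; cong)

basicHeight-lt : ∀ {n} (i j : Fin n) (l e g : DTree n) → suc (basicHeight l) ≤ basicHeight (node i j l e g)
basicHeight-lt _ _ _ e _ = ≤-trans (m≤m⊔n _ (basicHeight e)) (m≤m⊔n _ _)

basicHeight-eq : ∀ {n} (i j : Fin n) (l e g : DTree n) → basicHeight e ≤ basicHeight (node i j l e g)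
basicHeight-eq _ _ l _ _ = ≤-trans (m≤n⊔m (suc (basicHeight l)) _) (m≤m⊔n _ _)

basicHeight-gt : ∀ {n} (i j : Fin n) (l e g : DTree n) → suc (basicHeight g) ≤ basicHeight (node i j l e g)
basicHeight-gt _ _ _ _ _ = m≤n⊔m _ _

⊔-lub₃-< : ∀ {a b c m} → a < m → b < m → c < m → a ⊔ b ⊔ c < m
⊔-lub₃-< (s≤s a≤m) (s≤s b≤m) (s≤s c≤m) = s≤s (⊔-lub (⊔-lub a≤m b≤m) c≤m)

-- A partition of the positions, each block represented by one of its members.
record Partition (n : ℕ) : Set where
  field
    rep      : Fin n → Fin n
    rep-idem : ∀ x → rep (rep x) ≡ rep x

open Partition

module _ {n : ℕ} where

  discrete : Partition n
  discrete = record { rep = id ; rep-idem = λ _ → refl }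

  merge : (π : Partition n) (i j : Fin n) → ¬ rep π i ≡ rep π j → Partition n
  merge π i j πi≢πj = record { rep = rep′ ; rep-idem = rep′-idem }
    where
    rep′ : Fin n → Fin n
    rep′ x with rep π x ≟ rep π j
    ... | yes _ = rep π i
    ... | no  _ = rep π x

    rep′-idem : ∀ x → rep′ (rep′ x) ≡ rep′ x
    rep′-idem x with rep π x ≟ rep π j
    rep′-idem x | yes _ with rep π (rep π i) ≟ rep π j
    ... | yes πi≡πj = contradiction (trans (sym (rep-idem π i)) πi≡πj) πi≢πj
    ... | no  _     = rep-idem π i
    rep′-idem x | no πx≢πj with rep π (rep π x) ≟ rep π j
    ... | yes πx≡πj = contradiction (trans (sym (rep-idem π x)) πx≡πj) πx≢πj
    ... | no  _     = rep-idem π x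

  merge-fixed⇒fixed : ∀ π {i j} (πi≢πj : ¬ rep π i ≡ rep π j) {x} →
    rep (merge π i j πi≢πj) x ≡ x → rep π x ≡ x
  merge-fixed⇒fixed π {i} {j} _ {x} fixed with rep π x ≟ rep π j
  ... | yes _ = trans (cong (rep π) (sym fixed)) (trans (rep-idem π i) fixed)
  ... | no  _ = fixed

  merge-moves-rep : ∀ π {i j} (πi≢πj : ¬ rep π i ≡ rep π j) →
    ¬ rep (merge π i j πi≢πj) (rep π j) ≡ rep π j
  merge-moves-rep π {j = j} πi≢πj with rep π (rep π j) ≟ rep π j
  ... | yes _       = πi≢πj
  ... | no  πj-moved = contradiction (rep-idem π j) πj-moved

  representatives : Partition n → Subset n
  representatives π = tabulate (λ x → does (rep π x ≟ x))

  ∈-representatives⁺ : ∀ π {x} → rep π x ≡ x → x ∈ representatives π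
  ∈-representatives⁺ π {x} fixed =
    lookup⇒[]= x _ (trans (lookup∘tabulate _ x) (dec-true (rep π x ≟ x) fixed))

  ∈-representatives⁻ : ∀ π {x} → x ∈ representatives π → rep π x ≡ x
  ∈-representatives⁻ π {x} x∈
    with rep π x ≟ x | trans (sym (lookup∘tabulate _ x)) ([]=⇒lookup x∈)
  ... | yes fixed | _  = fixed
  ... | no  _     | ()

  representatives-merge⊂ : ∀ π {i j} (πi≢πj : ¬ rep π i ≡ rep π j) →
    representatives (merge π i j πi≢πj) ⊂ representatives π
  representatives-merge⊂ π {i} {j} πi≢πj =
      (λ x∈ → ∈-representatives⁺ π (merge-fixed⇒fixed π πi≢πj (∈-representatives⁻ π′ x∈)))
    , rep π j
    , ∈-representatives⁺ π (rep-idem π j)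
    , λ πj∈ → merge-moves-rep π πi≢πj (∈-representatives⁻ π′ πj∈)
    where π′ = merge π i j πi≢πj

  #blocks : Partition n → ℕ
  #blocks π = ∣ representatives π ∣

  #blocks-merge : ∀ π {i j} (πi≢πj : ¬ rep π i ≡ rep π j) →
    #blocks (merge π i j πi≢πj) < #blocks π
  #blocks-merge π πi≢πj = p⊂q⇒∣p∣<∣q∣ (representatives-merge⊂ π πi≢πj)

  -- π records the equalities already forced on the path to the current vertex.
  prune : Partition n → DTree n → DTree n
  prune π leaf = leaf
  prune π (node i j l e g) with rep π i ≟ rep π j
  ... | yes _     = prune π e
  ... | no πi≢πj = node i j (prune π l) (prune (merge π i j πi≢πj) e) (prune π g)

  height-prune : ∀ π T → height (prune π T) ≤ basicHeight T + #blocks π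
  height-prune π leaf = z≤n
  height-prune π (node i j l e g) with rep π i ≟ rep π j
  ... | yes _ = ≤-trans (height-prune π e) (+-monoˡ-≤ (#blocks π) (basicHeight-eq i j l e g))
  ... | no πi≢πj = ⊔-lub₃-<
    (≤-trans (s≤s (height-prune π l)) (+-monoˡ-≤ (#blocks π) (basicHeight-lt i j l e g)))
    (≤-trans (s≤s (height-prune (merge π i j πi≢πj) e))
      (≤-trans (≤-reflexive (sym (+-suc (basicHeight e) _)))
        (+-mono-≤ (basicHeight-eq i j l e g) (#blocks-merge π πi≢πj))))
    (≤-trans (s≤s (height-prune π g)) (+-monoˡ-≤ (#blocks π) (basicHeight-gt i j l e g)))

module _ {a ℓ₁ ℓ₂ : Level} (O : StrictTotalOrder a ℓ₁ ℓ₂) {n : ℕ} where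
  open StrictTotalOrder O using (_≈_; irrefl; module Eq) renaming (_<_ to _≺_)

  Respects : Partition n → String O n → Set ℓ₁
  Respects π t = ∀ x → t x ≈ t (rep π x)

  respects-discrete : ∀ t → Respects discrete t
  respects-discrete t x = Eq.refl

  ≈-if-same-block : ∀ π {t} → Respects π t → ∀ {i j} → rep π i ≡ rep π j → t i ≈ t j
  ≈-if-same-block π {t} resp {i} {j} πi≡πj =
    Eq.trans (resp i) (Eq.trans (Eq.reflexive (cong t πi≡πj)) (Eq.sym (resp j)))

  respects-merge : ∀ π {t i j} (πi≢πj : ¬ rep π i ≡ rep π j) →
    Respects π t → t i ≈ t j → Respects (merge π i j πi≢πj) t
  respects-merge π {t} {i} {j} _ resp ti≈tj x with rep π x ≟ rep π j
  ... | yes πx≡πj = Eq.trans (≈-if-same-block π resp πx≡πj) (Eq.trans (Eq.sym ti≈tj) (resp i))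
  ... | no  _     = resp x

  module _ {t : String O n} {i j : Fin n} {l e g l′ e′ g′ : DTree n} where

    viaLt-cong : ∀ {p q} → (t i ≺ t j → Reaches O t l p ⇔ Reaches O t l′ q) →
      Reaches O t (node i j l e g) (viaLt p) ⇔ Reaches O t (node i j l′ e′ g′) (viaLt q)
    viaLt-cong f = mk⇔ (λ { (rLt lt R) → rLt lt (Equivalence.to   (f lt) R) })
                       (λ { (rLt lt R) → rLt lt (Equivalence.from (f lt) R) })

    viaEq-cong : ∀ {p q} → (t i ≈ t j → Reaches O t e p ⇔ Reaches O t e′ q) →
      Reaches O t (node i j l e g) (viaEq p) ⇔ Reaches O t (node i j l′ e′ g′) (viaEq q)
    viaEq-cong f = mk⇔ (λ { (rEq eq R) → rEq eq (Equivalence.to   (f eq) R) })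
                       (λ { (rEq eq R) → rEq eq (Equivalence.from (f eq) R) })

    viaGt-cong : ∀ {p q} → (t j ≺ t i → Reaches O t g p ⇔ Reaches O t g′ q) →
      Reaches O t (node i j l e g) (viaGt p) ⇔ Reaches O t (node i j l′ e′ g′) (viaGt q)
    viaGt-cong f = mk⇔ (λ { (rGt gt R) → rGt gt (Equivalence.to   (f gt) R) })
                       (λ { (rGt gt R) → rGt gt (Equivalence.from (f gt) R) })

  viaEq-forced : ∀ {t : String O n} {i j l e g p} → t i ≈ t j →
    Reaches O t (node i j l e g) (viaEq p) ⇔ Reaches O t e p
  viaEq-forced ti≈tj = mk⇔ (λ { (rEq _ R) → R }) (rEq ti≈tj)

  prune-leaf : ∀ π T p (t : String O n) → Respects π t → Reaches O t T p →
    Σ (LeafOf (prune π T)) λ q →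
      ∀ t′ → Respects π t′ → Reaches O t′ T p ⇔ Reaches O t′ (prune π T) q
  prune-leaf π leaf here _ _ rHere = here , λ _ _ → ⇔-refl
  prune-leaf π (node i j l e g) p t resp R with rep π i ≟ rep π j
  prune-leaf π (node i j l e g) (viaLt p) t resp (rLt ti≺tj _) | yes πi≡πj =
    ⊥-elim (irrefl (≈-if-same-block π resp πi≡πj) ti≺tj)
  prune-leaf π (node i j l e g) (viaGt p) t resp (rGt tj≺ti _) | yes πi≡πj =
    ⊥-elim (irrefl (Eq.sym (≈-if-same-block π resp πi≡πj)) tj≺ti)
  prune-leaf π (node i j l e g) (viaEq p) t resp (rEq _ R) | yes πi≡πj =
    let q , sound = prune-leaf π e p t resp R in
    q , λ t′ resp′ → ⇔-trans (viaEq-forced (≈-if-same-block π resp′ πi≡πj)) (sound t′ resp′)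
  prune-leaf π (node i j l e g) (viaLt p) t resp (rLt _ R) | no _ =
    let q , sound = prune-leaf π l p t resp R in
    viaLt q , λ t′ resp′ → viaLt-cong λ _ → sound t′ resp′
  prune-leaf π (node i j l e g) (viaGt p) t resp (rGt _ R) | no _ =
    let q , sound = prune-leaf π g p t resp R in
    viaGt q , λ t′ resp′ → viaGt-cong λ _ → sound t′ resp′
  prune-leaf π (node i j l e g) (viaEq p) t resp (rEq ti≈tj R) | no πi≢πj =
    let q , sound = prune-leaf (merge π i j πi≢πj) e p t (respects-merge π πi≢πj resp ti≈tj) R in
    viaEq q , λ t′ resp′ → viaEq-cong λ t′i≈t′j →
      sound t′ (respects-merge π πi≢πj resp′ t′i≈t′j)

lemma9 : {a ℓ₁ ℓ₂ : Level} (O : StrictTotalOrder a ℓ₁ ℓ₂) (n k : ℕ) (T : DTree n) →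
    basicHeight T ≡ k →
    Σ (DTree n) λ T′ → (height T′ ≤ k + n) × Equivalent O T T′
lemma9 O n k T refl = prune discrete T , height-bound , equivalent
  where
  height-bound : height (prune discrete T) ≤ basicHeight T + n
  height-bound = ≤-trans (height-prune discrete T)
                         (+-monoʳ-≤ (basicHeight T) (∣p∣≤n (representatives discrete)))

  equivalent : Equivalent O T (prune discrete T)
  equivalent p (t , R) =
    let q , sound = prune-leaf O discrete T p t (respects-discrete O t) R in
    q , λ t′ → sound t′ (respects-discrete O t′)
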